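{- Let $\phi(X)$ be an MSO formula with one free set variable $X$. Let $G$ be a labeled colored graph and $S_1,S_2$ two sets of vertices of $G$ such that all vertices of $(S_1\setminus S_2)\cup(S_2\setminus S_1)$ are unlabeled and have the same type, and furthermore $|S_1\setminus S_2|=|S_2\setminus S_1|$. Then $G\models\phi(S_1)$ if and only if $G\models\phi(S_2)$.
   Context: A labeled colored graph is a finite simple undirected graph $G=(V,E)$ with a finite set of labels, each assigned to a vertex (a vertex is unlabeled if no label is assigned to it), and a finite collection of (not necessarily disjoint) subsets of $V$ called color classes. MSO formulas (here MSO means MSO$_1$) are built from vertex variables, vertex-set variables, labels (as constants), color class symbols, atoms $E(s,t)$, $s=t$, $s\in C$ (with $C$ a color class or a set variable), Boolean connectives, and quantifiers over vertices and over sets of vertices, with standard semantics. $G\models\phi(S)$ means $\phi$ holds with $X$ interpreted as $S\subseteq V$. Two vertices $v,v'$ have the same type iff they belong to the same color classes and $N(v)\setminus\{v'\}=N(v')\setminus\{v\}$, where $N(v)$ is the neighborhood of $v$. -}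

module Defs where

open import Data.Nat using (ℕ; suc)
open import Data.Fin using (Fin; zero; suc)
open import Data.Fin.Subset using (Subset; _∈_; _─_; _∪_; ∣_∣)
open import Data.Bool using (Bool; true; false)
open import Data.Vec using (Vec; []; _∷_; lookup)
open import Data.Product using (Σ; _×_)
open import Data.Sum using (_⊎_)
open import Data.Empty using (⊥)
open import Relation.Nullary using (¬_)
open import Relation.Binary.PropositionalEquality using (_≡_; _≢_)
open import Function.Bundles using (_⇔_)

record LCGraph (L C n : ℕ) : Set where
  field
    adj     : Fin n → Fin n → Bool
    adj-sym : ∀ u v → adj u v ≡ adj v u
    adj-irr : ∀ v → adj v v ≡ false
    label   : Fin L → Fin n
    color   : Fin C → Subset n               -- color classes (not necessarily disjoint)

open LCGraph public

Adj : ∀ {L C n} → LCGraph L C n → Fin n → Fin n → Set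
Adj G u v = adj G u v ≡ true

Unlabeled : ∀ {L C n} → LCGraph L C n → Fin n → Set
Unlabeled G v = ∀ l → label G l ≢ v

SameType : ∀ {L C n} → LCGraph L C n → Fin n → Fin n → Set
SameType G v v' =
  (∀ c → (v ∈ color G c) ⇔ (v' ∈ color G c)) ×
  (∀ w → (Adj G v w × w ≢ v') ⇔ (Adj G v' w × w ≢ v))

-- MSO terms: a vertex variable (de Bruijn index among nv vertex variables) or a label constant.
data Term (L nv : ℕ) : Set where
  var : Fin nv → Term L nv
  lab : Fin L → Term L nv

-- MSO₁ formulas over L labels and C color classes, with nv vertex variables
-- and ns set variables in scope (de Bruijn indices).
data Formula (L C : ℕ) : ℕ → ℕ → Set where
  edge  : ∀ {nv ns} → Term L nv → Term L nv → Formula L C nv ns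
  eq    : ∀ {nv ns} → Term L nv → Term L nv → Formula L C nv ns
  inCol : ∀ {nv ns} → Term L nv → Fin C → Formula L C nv ns
  inVar : ∀ {nv ns} → Term L nv → Fin ns → Formula L C nv ns
  neg   : ∀ {nv ns} → Formula L C nv ns → Formula L C nv ns
  and   : ∀ {nv ns} → Formula L C nv ns → Formula L C nv ns → Formula L C nv ns
  or    : ∀ {nv ns} → Formula L C nv ns → Formula L C nv ns → Formula L C nv ns
  imp   : ∀ {nv ns} → Formula L C nv ns → Formula L C nv ns → Formula L C nv ns
  ex1   : ∀ {nv ns} → Formula L C (suc nv) ns → Formula L C nv ns
  all1  : ∀ {nv ns} → Formula L C (suc nv) ns → Formula L C nv ns
  ex2   : ∀ {nv ns} → Formula L C nv (suc ns) → Formula L C nv ns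
  all2  : ∀ {nv ns} → Formula L C nv (suc ns) → Formula L C nv ns

evalTerm : ∀ {L C n nv} → LCGraph L C n → Vec (Fin n) nv → Term L nv → Fin n
evalTerm G ρ (var i) = lookup ρ i
evalTerm G ρ (lab l) = label G l

Sat : ∀ {L C n nv ns} → LCGraph L C n → Vec (Fin n) nv → Vec (Subset n) ns →
      Formula L C nv ns → Set
Sat G ρ σ (edge s t)  = Adj G (evalTerm G ρ s) (evalTerm G ρ t)
Sat G ρ σ (eq s t)    = evalTerm G ρ s ≡ evalTerm G ρ t
Sat G ρ σ (inCol s c) = evalTerm G ρ s ∈ color G c
Sat G ρ σ (inVar s x) = evalTerm G ρ s ∈ lookup σ x
Sat G ρ σ (neg φ)     = ¬ Sat G ρ σ φ
Sat G ρ σ (and φ ψ)   = Sat G ρ σ φ × Sat G ρ σ ψ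
Sat G ρ σ (or φ ψ)    = Sat G ρ σ φ ⊎ Sat G ρ σ ψ
Sat G ρ σ (imp φ ψ)   = Sat G ρ σ φ → Sat G ρ σ ψ
Sat G ρ σ (ex1 φ)     = Σ (Fin _) λ v → Sat G (v ∷ ρ) σ φ
Sat G ρ σ (all1 φ)    = ∀ v → Sat G (v ∷ ρ) σ φ
Sat G ρ σ (ex2 φ)     = Σ (Subset _) λ S → Sat G ρ (S ∷ σ) φ
Sat G ρ σ (all2 φ)    = ∀ S → Sat G ρ (S ∷ σ) φ

-- G ⊨ φ(S) for a formula with exactly one free set variable X (index zero) and no free vertex variables.
_⊨_[_] : ∀ {L C n} → LCGraph L C n → Formula L C 0 1 → Subset n → Set
G ⊨ φ [ S ] = Sat G [] (S ∷ []) φ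

SymDiff : ∀ {n} → Subset n → Subset n → Subset n
SymDiff S₁ S₂ = (S₁ ─ S₂) ∪ (S₂ ─ S₁)

module Submission where

-- A graph automorphism that fixes every labelled vertex preserves
-- the satisfaction of every MSO formula, provided vertex and set variables
-- are transported along it (Sat-invariant, proved by induction on the
-- formula).  If a and b are unlabelled vertices of the same type, the
-- transposition (a b) is such an automorphism (transposition).  Now let
-- k = |S₁ ∖ S₂| = |S₂ ∖ S₁|.  If k = 0 then S₁ = S₂.  Otherwise pick
-- a ∈ S₁ ∖ S₂ and b ∈ S₂ ∖ S₁; the transposition (a b) maps S₁ to a set S'
-- with G ⊨ φ(S₁) ⇔ G ⊨ φ(S'), whose differences with S₂ are those of S₁
-- with a resp. b removed (module Exchange), so both have size k - 1
-- and S' still differs from S₂ only in interchangeable vertices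
-- (exchange-step).  The theorem follows by induction on k
-- (exchange-invariance).

open import Defs
open import Data.Nat using (ℕ; zero; suc)
open import Data.Nat.Properties using (suc-injective; 0≢1+n)
open import Data.Fin using (Fin; _≟_)
open import Data.Fin.Subset
  using (Subset; _∈_; _∉_; _⊆_; _─_; _-_; ⁅_⁆; ∣_∣; Nonempty; inside; outside)
open import Data.Fin.Subset.Properties
  using ( _∈?_; nonempty?; Empty-unique; ∣⊥∣≡0; ⊆-antisym; p─⊥≡p; p─q⊆p
        ; x∈p∧x∉q⇒x∈p─q; x∈p∧x≢y⇒x∈p-y; x∈p∪q⁺; x∈p∪q⁻; x∉⁅y⁆⇒x≢y)
import Data.Fin.Permutation.Components as PC
open import Data.Fin.Permutation
  using (Permutation′; _⟨$⟩ʳ_; _⟨$⟩ˡ_; inverseˡ; inverseʳ; transpose)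
open import Data.Vec using (Vec; []; _∷_; here; there; lookup; map; tabulate)
open import Data.Vec.Properties
  using ([]=⇒lookup; lookup⇒[]=; lookup-map; lookup∘tabulate; tabulate∘lookup; tabulate-cong)
open import Data.Product using (Σ; _×_; _,_; proj₁; proj₂)
open import Data.Sum using (inj₁; inj₂)
import Data.Sum as Sum
open import Relation.Nullary using (yes; no; contradiction)
open import Relation.Nullary.Decidable using (dec-true; dec-false)
open import Relation.Binary.PropositionalEquality
  using (_≡_; _≢_; refl; sym; trans; cong; subst; ≢-sym; module ≡-Reasoning)
open import Function.Base using (_∘′_)
open import Function.Bundles using (_⇔_; mk⇔; Equivalence; _↔_; Inverse; Injection; mk↔ₛ′)
import Function.Properties.Equivalence as ⇔
open import Function.Properties.Inverse using (↔⇒↠; ↔⇒↣)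
open import Function.Related.TypeIsomorphisms using (→-cong-⇔; ¬-cong-⇔)
open import Data.Product.Function.NonDependent.Propositional using (_×-⇔_)
open import Data.Product.Function.Dependent.Propositional using (Σ-⇔)
open import Data.Sum.Function.Propositional using (_⊎-⇔_)

open Equivalence using (to; from)

-- Logical equivalence is a congruence for ∀ along a bijection of the domain;
-- the library provides the analogue Σ-⇔ for Σ but not this one.
Π-⇔ : {I J : Set} {A : I → Set} {B : J → Set} (e : I ↔ J) →
      (∀ {i} → A i ⇔ B (Inverse.to e i)) → ((i : I) → A i) ⇔ ((j : J) → B j)
Π-⇔ {B = B} e A⇔B = mk⇔
  (λ h j → subst B (Inverse.strictlyInverseˡ e j) (to A⇔B (h (Inverse.from e j))))
  (λ h i → from A⇔B (h (Inverse.to e i)))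

preimage : ∀ {m n} → (Fin m → Fin n) → Subset n → Subset m
preimage f S = tabulate (λ x → lookup S (f x))

∈-preimage : ∀ {m n} (f : Fin m → Fin n) (S : Subset n) {x} → x ∈ preimage f S ⇔ f x ∈ S
∈-preimage f S {x} = mk⇔
  (λ x∈ → lookup⇒[]= (f x) S (trans (sym (lookup∘tabulate _ x)) ([]=⇒lookup x∈)))
  (λ fx∈ → lookup⇒[]= x _ (trans (lookup∘tabulate _ x) ([]=⇒lookup fx∈)))

preimage-inverse : ∀ {m n} (f : Fin m → Fin n) (g : Fin n → Fin m) →
                   (∀ x → g (f x) ≡ x) → ∀ S → preimage f (preimage g S) ≡ S
preimage-inverse f g g∘f≗id S = begin
  tabulate (λ x → lookup (tabulate (λ y → lookup S (g y))) (f x))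
    ≡⟨ tabulate-cong (λ x → trans (lookup∘tabulate _ (f x)) (cong (lookup S) (g∘f≗id x))) ⟩
  tabulate (lookup S)
    ≡⟨ tabulate∘lookup S ⟩
  S ∎
  where open ≡-Reasoning

x∈p─q⇒x∉q : ∀ {n} {x : Fin n} (p q : Subset n) → x ∈ p ─ q → x ∉ q
x∈p─q⇒x∉q (s ∷ p) (outside ∷ q) here        ()
x∈p─q⇒x∉q (s ∷ p) (outside ∷ q) (there x∈) (there x∈q) = x∈p─q⇒x∉q p q x∈ x∈q
x∈p─q⇒x∉q (s ∷ p) (inside  ∷ q) (there x∈) (there x∈q) = x∈p─q⇒x∉q p q x∈ x∈q

x∈p-y⇒x≢y : ∀ {n} {x y : Fin n} (p : Subset n) → x ∈ p - y → x ≢ y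
x∈p-y⇒x≢y {y = y} p x∈ = x∉⁅y⁆⇒x≢y (x∈p─q⇒x∉q p ⁅ y ⁆ x∈)

∈∉⇒≢ : ∀ {n} {x y : Fin n} {p : Subset n} → x ∈ p → y ∉ p → x ≢ y
∈∉⇒≢ x∈p y∉p refl = y∉p x∈p

∣p∣≡1+∣p-x∣ : ∀ {n} {x : Fin n} {p : Subset n} → x ∈ p → ∣ p ∣ ≡ suc ∣ p - x ∣
∣p∣≡1+∣p-x∣ {p = inside  ∷ p} here        = cong suc (cong ∣_∣ (sym (p─⊥≡p p)))
∣p∣≡1+∣p-x∣ {p = inside  ∷ p} (there x∈p) = cong suc (∣p∣≡1+∣p-x∣ x∈p)
∣p∣≡1+∣p-x∣ {p = outside ∷ p} (there x∈p) = ∣p∣≡1+∣p-x∣ x∈p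

count-after-removal : ∀ {n k} {x : Fin n} {p : Subset n} → x ∈ p → ∣ p ∣ ≡ suc k → ∣ p - x ∣ ≡ k
count-after-removal x∈p ∣p∣≡1+k = suc-injective (trans (sym (∣p∣≡1+∣p-x∣ x∈p)) ∣p∣≡1+k)

∣p∣≡0⇒x∉p : ∀ {n} {x : Fin n} {p : Subset n} → ∣ p ∣ ≡ 0 → x ∉ p
∣p∣≡0⇒x∉p ∣p∣≡0 x∈p = 0≢1+n (trans (sym ∣p∣≡0) (∣p∣≡1+∣p-x∣ x∈p))

∣p∣≡1+k⇒Nonempty : ∀ {n k} {p : Subset n} → ∣ p ∣ ≡ suc k → Nonempty p
∣p∣≡1+k⇒Nonempty {n} {p = p} ∣p∣≡1+k with nonempty? p
... | yes p≠∅ = p≠∅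
... | no p=∅ = contradiction
  (trans (sym ∣p∣≡1+k) (trans (cong ∣_∣ (Empty-unique p=∅)) (∣⊥∣≡0 n))) (λ ())

∣p─q∣≡0⇒p⊆q : ∀ {n} {p q : Subset n} → ∣ p ─ q ∣ ≡ 0 → p ⊆ q
∣p─q∣≡0⇒p⊆q {q = q} ∣p─q∣≡0 {x} x∈p with x ∈? q
... | yes x∈q = x∈q
... | no x∉q = contradiction (x∈p∧x∉q⇒x∈p─q x∈p x∉q) (∣p∣≡0⇒x∉p ∣p─q∣≡0)

module Exchange {n} {S T R : Subset n} {a b : Fin n}
  (a∉T : a ∉ T) (b∈T : b ∈ T) (b∉S : b ∉ S) (a∉R : a ∉ R) (b∈R : b ∈ R)
  (agree : ∀ {x} → x ≢ a → x ≢ b → x ∈ T ⇔ x ∈ S) where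

  T─R≡S─R-a : T ─ R ≡ (S ─ R) - a
  T─R≡S─R-a = ⊆-antisym T─R⊆S─R-a S─R-a⊆T─R
    where
    T─R⊆S─R-a : T ─ R ⊆ (S ─ R) - a
    T─R⊆S─R-a {x} x∈ = x∈p∧x≢y⇒x∈p-y (x∈p∧x∉q⇒x∈p─q x∈S x∉R) x≢a
      where
      x∈T : x ∈ T
      x∈T = p─q⊆p T R x∈
      x∉R : x ∉ R
      x∉R = x∈p─q⇒x∉q T R x∈
      x≢a : x ≢ a
      x≢a = ∈∉⇒≢ x∈T a∉T
      x∈S : x ∈ S
      x∈S = to (agree x≢a (≢-sym (∈∉⇒≢ b∈R x∉R))) x∈T
    S─R-a⊆T─R : (S ─ R) - a ⊆ T ─ R
    S─R-a⊆T─R {x} x∈ = x∈p∧x∉q⇒x∈p─q (from (agree x≢a (∈∉⇒≢ x∈S b∉S)) x∈S) x∉R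
      where
      x≢a : x ≢ a
      x≢a = x∈p-y⇒x≢y (S ─ R) x∈
      x∈S : x ∈ S
      x∈S = p─q⊆p S R (p─q⊆p (S ─ R) ⁅ a ⁆ x∈)
      x∉R : x ∉ R
      x∉R = x∈p─q⇒x∉q S R (p─q⊆p (S ─ R) ⁅ a ⁆ x∈)

  R─T≡R─S-b : R ─ T ≡ (R ─ S) - b
  R─T≡R─S-b = ⊆-antisym R─T⊆R─S-b R─S-b⊆R─T
    where
    R─T⊆R─S-b : R ─ T ⊆ (R ─ S) - b
    R─T⊆R─S-b {x} x∈ = x∈p∧x≢y⇒x∈p-y (x∈p∧x∉q⇒x∈p─q x∈R x∉S) x≢b
      where
      x∈R : x ∈ R
      x∈R = p─q⊆p R T x∈
      x∉T : x ∉ T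
      x∉T = x∈p─q⇒x∉q R T x∈
      x≢b : x ≢ b
      x≢b = ≢-sym (∈∉⇒≢ b∈T x∉T)
      x∉S : x ∉ S
      x∉S = x∉T ∘′ from (agree (∈∉⇒≢ x∈R a∉R) x≢b)
    R─S-b⊆R─T : (R ─ S) - b ⊆ R ─ T
    R─S-b⊆R─T {x} x∈ = x∈p∧x∉q⇒x∈p─q x∈R (x∉S ∘′ to (agree (∈∉⇒≢ x∈R a∉R) x≢b))
      where
      x≢b : x ≢ b
      x≢b = x∈p-y⇒x≢y (R ─ S) x∈
      x∈R : x ∈ R
      x∈R = p─q⊆p R S (p─q⊆p (R ─ S) ⁅ b ⁆ x∈)
      x∉S : x ∉ S
      x∉S = x∈p─q⇒x∉q R S (p─q⊆p (R ─ S) ⁅ b ⁆ x∈)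

  SymDiff-shrinks : SymDiff T R ⊆ SymDiff S R
  SymDiff-shrinks {x} x∈ = x∈p∪q⁺ (Sum.map left right (x∈p∪q⁻ (T ─ R) (R ─ T) x∈))
    where
    left : x ∈ T ─ R → x ∈ S ─ R
    left h = p─q⊆p (S ─ R) ⁅ a ⁆ (subst (x ∈_) T─R≡S─R-a h)
    right : x ∈ R ─ T → x ∈ R ─ S
    right h = p─q⊆p (R ─ S) ⁅ b ⁆ (subst (x ∈_) R─T≡R─S-b h)

transpose-matchˡ : ∀ {n} (i j : Fin n) → PC.transpose i j i ≡ j
transpose-matchˡ i j rewrite dec-true (i ≟ i) refl = refl

transpose-matchʳ : ∀ {n} (i j : Fin n) → PC.transpose i j j ≡ i
transpose-matchʳ i j with j ≟ i
... | yes j≡i = j≡i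
... | no _ rewrite dec-true (j ≟ j) refl = refl

transpose-other : ∀ {n} {i j k : Fin n} → k ≢ i → k ≢ j → PC.transpose i j k ≡ k
transpose-other {i = i} {j} {k} k≢i k≢j
  rewrite dec-false (k ≟ i) k≢i | dec-false (k ≟ j) k≢j = refl

data Place {n} (i j k : Fin n) : Set where
  at-i      : k ≡ i → Place i j k
  at-j      : k ≡ j → Place i j k
  elsewhere : k ≢ i → k ≢ j → Place i j k

place : ∀ {n} (i j k : Fin n) → Place i j k
place i j k with k ≟ i | k ≟ j
... | yes k≡i | _       = at-i k≡i
... | no _    | yes k≡j = at-j k≡j
... | no k≢i  | no k≢j  = elsewhere k≢i k≢j

-- Trading a ∈ S for b ∉ S: the preimage of S under the transposition (b a),
-- i.e. the image of S under (a b).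
module Trade {n} {S : Subset n} {a b : Fin n} (a∈S : a ∈ S) (b∉S : b ∉ S) where
  traded : Subset n
  traded = preimage (PC.transpose b a) S

  a∉traded : a ∉ traded
  a∉traded a∈ = b∉S (subst (_∈ S) (transpose-matchʳ b a) (to (∈-preimage _ S) a∈))

  b∈traded : b ∈ traded
  b∈traded = from (∈-preimage _ S) (subst (_∈ S) (sym (transpose-matchˡ b a)) a∈S)

  traded-agrees : ∀ {x} → x ≢ a → x ≢ b → x ∈ traded ⇔ x ∈ S
  traded-agrees {x} x≢a x≢b = subst (λ y → x ∈ traded ⇔ y ∈ S)
    (transpose-other x≢b x≢a) (∈-preimage (PC.transpose b a) S)

Adj-sym : ∀ {L C n} (G : LCGraph L C n) {u v} → Adj G u v ⇔ Adj G v u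
Adj-sym G {u} {v} = mk⇔ (trans (adj-sym G v u)) (trans (adj-sym G u v))

-- No vertex is adjacent to itself, so all loop statements are equivalent.
Adj-loop : ∀ {L C n} (G : LCGraph L C n) {u v} → Adj G u u ⇔ Adj G v v
Adj-loop G {u} {v} = mk⇔ (λ uu → contradiction (trans (sym (adj-irr G u)) uu) (λ ()))
                         (λ vv → contradiction (trans (sym (adj-irr G v)) vv) (λ ()))

record Automorphism {L C n} (G : LCGraph L C n) : Set where
  field
    perm            : Permutation′ n
    preserves-adj   : ∀ u v → Adj G u v ⇔ Adj G (perm ⟨$⟩ʳ u) (perm ⟨$⟩ʳ v)
    preserves-color : ∀ c v → v ∈ color G c ⇔ perm ⟨$⟩ʳ v ∈ color G c
    fixes-labels    : ∀ l → perm ⟨$⟩ʳ label G l ≡ label G l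

module _ {L C n} {G : LCGraph L C n} (α : Automorphism G) where
  open Automorphism α

  -- The image α[S] of a vertex set, its membership rule, and α[_] as a
  -- bijection on vertex sets (needed for the set quantifiers).
  image : Subset n → Subset n
  image = preimage (perm ⟨$⟩ˡ_)

  ∈-image : ∀ S v → v ∈ S ⇔ perm ⟨$⟩ʳ v ∈ image S
  ∈-image S v = ⇔.sym (subst (λ w → perm ⟨$⟩ʳ v ∈ image S ⇔ w ∈ S)
    (inverseˡ perm) (∈-preimage (perm ⟨$⟩ˡ_) S))

  image-↔ : Subset n ↔ Subset n
  image-↔ = mk↔ₛ′ image (preimage (perm ⟨$⟩ʳ_))
    (preimage-inverse (perm ⟨$⟩ˡ_) (perm ⟨$⟩ʳ_) (λ _ → inverseʳ perm))
    (preimage-inverse (perm ⟨$⟩ʳ_) (perm ⟨$⟩ˡ_) (λ _ → inverseˡ perm))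

  evalTerm-image : ∀ {nv} (ρ : Vec (Fin n) nv) t →
                   evalTerm G (map (perm ⟨$⟩ʳ_) ρ) t ≡ perm ⟨$⟩ʳ evalTerm G ρ t
  evalTerm-image ρ (var i) = lookup-map i _ ρ
  evalTerm-image ρ (lab l) = sym (fixes-labels l)

  Sat-invariant : ∀ {nv ns} (φ : Formula L C nv ns) ρ σ →
                  Sat G ρ σ φ ⇔ Sat G (map (perm ⟨$⟩ʳ_) ρ) (map image σ) φ
  Sat-invariant (edge s t) ρ σ rewrite evalTerm-image ρ s | evalTerm-image ρ t =
    preserves-adj _ _
  Sat-invariant (eq s t) ρ σ rewrite evalTerm-image ρ s | evalTerm-image ρ t =
    mk⇔ (cong (perm ⟨$⟩ʳ_)) (Injection.injective (↔⇒↣ perm))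
  Sat-invariant (inCol s c) ρ σ rewrite evalTerm-image ρ s = preserves-color c _
  Sat-invariant (inVar s x) ρ σ rewrite evalTerm-image ρ s | lookup-map x image σ =
    ∈-image (lookup σ x) _
  Sat-invariant (neg φ) ρ σ = ¬-cong-⇔ (Sat-invariant φ ρ σ)
  Sat-invariant (and φ ψ) ρ σ = Sat-invariant φ ρ σ ×-⇔ Sat-invariant ψ ρ σ
  Sat-invariant (or φ ψ) ρ σ = Sat-invariant φ ρ σ ⊎-⇔ Sat-invariant ψ ρ σ
  Sat-invariant (imp φ ψ) ρ σ = →-cong-⇔ (Sat-invariant φ ρ σ) (Sat-invariant ψ ρ σ)
  Sat-invariant (ex1 φ) ρ σ = Σ-⇔ (↔⇒↠ perm) (λ {v} → Sat-invariant φ (v ∷ ρ) σ)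
  Sat-invariant (all1 φ) ρ σ = Π-⇔ perm (λ {v} → Sat-invariant φ (v ∷ ρ) σ)
  Sat-invariant (ex2 φ) ρ σ = Σ-⇔ (↔⇒↠ image-↔) (λ {S} → Sat-invariant φ ρ (S ∷ σ))
  Sat-invariant (all2 φ) ρ σ = Π-⇔ image-↔ (λ {S} → Sat-invariant φ ρ (S ∷ σ))

  ⊨-invariant : ∀ φ S → (G ⊨ φ [ S ]) ⇔ (G ⊨ φ [ image S ])
  ⊨-invariant φ S = Sat-invariant φ [] (S ∷ [])

transposition : ∀ {L C n} (G : LCGraph L C n) {a b : Fin n} →
                Unlabeled G a → Unlabeled G b → SameType G a b → Automorphism G
transposition G {a} {b} a-unlabeled b-unlabeled (same-colors , same-neighbours) = record
  { perm            = transpose a b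
  ; preserves-adj   = adj-swapped
  ; preserves-color = color-swapped
  ; fixes-labels    = λ l → transpose-other (a-unlabeled l) (b-unlabeled l)
  }
  where
  τ : Fin _ → Fin _
  τ = PC.transpose a b

  neighbours-agree : ∀ {w} → w ≢ a → w ≢ b → Adj G a w ⇔ Adj G b w
  neighbours-agree {w} w≢a w≢b = mk⇔
    (λ aw → proj₁ (to (same-neighbours w) (aw , w≢b)))
    (λ bw → proj₁ (from (same-neighbours w) (bw , w≢a)))

  adj-fixed : ∀ u {w} → w ≢ a → w ≢ b → Adj G u w ⇔ Adj G (τ u) w
  adj-fixed u w≢a w≢b with place a b u
  ... | at-i u≡a rewrite u≡a | transpose-matchˡ a b = neighbours-agree w≢a w≢b
  ... | at-j u≡b rewrite u≡b | transpose-matchʳ a b = ⇔.sym (neighbours-agree w≢a w≢b)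
  ... | elsewhere u≢a u≢b rewrite transpose-other u≢a u≢b = ⇔.refl

  adj-swapped : ∀ u v → Adj G u v ⇔ Adj G (τ u) (τ v)
  adj-swapped u v with place a b u | place a b v
  ... | _ | elsewhere v≢a v≢b rewrite transpose-other v≢a v≢b = adj-fixed u v≢a v≢b
  ... | elsewhere u≢a u≢b | _ rewrite transpose-other u≢a u≢b =
    ⇔.trans (Adj-sym G) (⇔.trans (adj-fixed v u≢a u≢b) (Adj-sym G))
  ... | at-i refl | at-i refl rewrite transpose-matchˡ a b = Adj-loop G
  ... | at-i refl | at-j refl rewrite transpose-matchˡ a b | transpose-matchʳ a b = Adj-sym G
  ... | at-j refl | at-i refl rewrite transpose-matchˡ a b | transpose-matchʳ a b = Adj-sym G
  ... | at-j refl | at-j refl rewrite transpose-matchʳ a b = Adj-loop G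

  color-swapped : ∀ c v → v ∈ color G c ⇔ τ v ∈ color G c
  color-swapped c v with place a b v
  ... | at-i v≡a rewrite v≡a | transpose-matchˡ a b = same-colors c
  ... | at-j v≡b rewrite v≡b | transpose-matchʳ a b = ⇔.sym (same-colors c)
  ... | elsewhere v≢a v≢b rewrite transpose-other v≢a v≢b = ⇔.refl

record Interchangeable {L C n} (G : LCGraph L C n) (D : Subset n) : Set where
  field
    unlabeled : ∀ v → v ∈ D → Unlabeled G v
    same-type : ∀ v v' → v ∈ D → v' ∈ D → SameType G v v'

Interchangeable-⊆ : ∀ {L C n} {G : LCGraph L C n} {D D' : Subset n} →
                    D' ⊆ D → Interchangeable G D → Interchangeable G D'
Interchangeable-⊆ D'⊆D I = record
  { unlabeled = λ v v∈ → unlabeled v (D'⊆D v∈)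
  ; same-type = λ v v' v∈ v'∈ → same-type v v' (D'⊆D v∈) (D'⊆D v'∈)
  }
  where open Interchangeable I

module _ {L C n} (G : LCGraph L C n) where

  exchange-step : ∀ {k} {S₁ S₂ : Subset n} →
    ∣ S₁ ─ S₂ ∣ ≡ suc k → ∣ S₂ ─ S₁ ∣ ≡ suc k → Interchangeable G (SymDiff S₁ S₂) →
    Σ (Subset n) λ S' → (∀ φ → (G ⊨ φ [ S₁ ]) ⇔ (G ⊨ φ [ S' ])) ×
                        ∣ S' ─ S₂ ∣ ≡ k × ∣ S₂ ─ S' ∣ ≡ k × SymDiff S' S₂ ⊆ SymDiff S₁ S₂
  exchange-step {k} {S₁} {S₂} ∣S₁─S₂∣≡1+k ∣S₂─S₁∣≡1+k I =
    traded , (λ φ → ⊨-invariant α φ S₁) , ∣traded─S₂∣≡k , ∣S₂─traded∣≡k , SymDiff-shrinks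
    where
    open Interchangeable I
    a b : Fin n
    a = proj₁ (∣p∣≡1+k⇒Nonempty ∣S₁─S₂∣≡1+k)
    b = proj₁ (∣p∣≡1+k⇒Nonempty ∣S₂─S₁∣≡1+k)
    a∈S₁─S₂ : a ∈ S₁ ─ S₂
    a∈S₁─S₂ = proj₂ (∣p∣≡1+k⇒Nonempty ∣S₁─S₂∣≡1+k)
    b∈S₂─S₁ : b ∈ S₂ ─ S₁
    b∈S₂─S₁ = proj₂ (∣p∣≡1+k⇒Nonempty ∣S₂─S₁∣≡1+k)
    a∈D : a ∈ SymDiff S₁ S₂
    a∈D = x∈p∪q⁺ (inj₁ a∈S₁─S₂)
    b∈D : b ∈ SymDiff S₁ S₂
    b∈D = x∈p∪q⁺ (inj₂ b∈S₂─S₁)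
    α : Automorphism G
    α = transposition G (unlabeled a a∈D) (unlabeled b b∈D) (same-type a b a∈D b∈D)
    -- traded is by definition the image of S₁ under α
    open Trade (p─q⊆p S₁ S₂ a∈S₁─S₂) (x∈p─q⇒x∉q S₂ S₁ b∈S₂─S₁)
    open Exchange a∉traded b∈traded (x∈p─q⇒x∉q S₂ S₁ b∈S₂─S₁)
                  (x∈p─q⇒x∉q S₁ S₂ a∈S₁─S₂) (p─q⊆p S₂ S₁ b∈S₂─S₁) traded-agrees
    ∣traded─S₂∣≡k : ∣ traded ─ S₂ ∣ ≡ k
    ∣traded─S₂∣≡k = subst (λ D → ∣ D ∣ ≡ k) (sym T─R≡S─R-a)
                      (count-after-removal a∈S₁─S₂ ∣S₁─S₂∣≡1+k)
    ∣S₂─traded∣≡k : ∣ S₂ ─ traded ∣ ≡ k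
    ∣S₂─traded∣≡k = subst (λ D → ∣ D ∣ ≡ k) (sym R─T≡R─S-b)
                      (count-after-removal b∈S₂─S₁ ∣S₂─S₁∣≡1+k)

  exchange-invariance : ∀ k {S₁ S₂ : Subset n} →
    ∣ S₁ ─ S₂ ∣ ≡ k → ∣ S₂ ─ S₁ ∣ ≡ k → Interchangeable G (SymDiff S₁ S₂) →
    ∀ φ → (G ⊨ φ [ S₁ ]) ⇔ (G ⊨ φ [ S₂ ])
  exchange-invariance zero {S₁} ∣S₁─S₂∣≡0 ∣S₂─S₁∣≡0 I φ =
    subst (λ S → (G ⊨ φ [ S₁ ]) ⇔ (G ⊨ φ [ S ]))
      (⊆-antisym (∣p─q∣≡0⇒p⊆q ∣S₁─S₂∣≡0) (∣p─q∣≡0⇒p⊆q ∣S₂─S₁∣≡0)) ⇔.refl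
  exchange-invariance (suc k) ∣S₁─S₂∣≡1+k ∣S₂─S₁∣≡1+k I φ
    with exchange-step ∣S₁─S₂∣≡1+k ∣S₂─S₁∣≡1+k I
  ... | S' , S₁≈S' , ∣S'─S₂∣≡k , ∣S₂─S'∣≡k , S'-closer =
    ⇔.trans (S₁≈S' φ)
      (exchange-invariance k ∣S'─S₂∣≡k ∣S₂─S'∣≡k (Interchangeable-⊆ S'-closer I) φ)

lemma3 : ∀ {L C n : ℕ} (φ : Formula L C 0 1) (G : LCGraph L C n) (S₁ S₂ : Subset n) →
    (∀ v → v ∈ SymDiff S₁ S₂ → Unlabeled G v) →
    (∀ v v' → v ∈ SymDiff S₁ S₂ → v' ∈ SymDiff S₁ S₂ → SameType G v v') →
    ∣ S₁ ─ S₂ ∣ ≡ ∣ S₂ ─ S₁ ∣ →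
    (G ⊨ φ [ S₁ ]) ⇔ (G ⊨ φ [ S₂ ])
lemma3 φ G S₁ S₂ unlabeled same-type ∣S₁─S₂∣≡∣S₂─S₁∣ =
  exchange-invariance G _ refl (sym ∣S₁─S₂∣≡∣S₂─S₁∣)
    (record { unlabeled = unlabeled ; same-type = same-type }) φ
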